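{- Every Steiner triple system $\mathrm{STS}(v)$ with $v > 3$ has a cyclic $3$-good sequencing.
   Context: A Steiner triple system $\mathrm{STS}(v)$ is a pair $(V,\mathcal{B})$ where $V$ is a set of $v$ points and $\mathcal{B}$ is a collection of $3$-element subsets of $V$ (blocks) such that every pair of distinct points lies in exactly one block; such systems exist iff $v \equiv 1$ or $3 \pmod 6$. For an integer $\ell \ge 3$, an $\ell$-good sequencing is an ordering $x_1,\dots,x_v$ of all points of $V$ such that no $\ell$ consecutive points $x_i,\dots,x_{i+\ell-1}$ contain a block. A cyclic $\ell$-good sequencing is an ordering $x_1,\dots,x_v$ such that for every $i$, the $\ell$ cyclically consecutive points $x_i,x_{i+1},\dots,x_{i+\ell-1}$ (indices taken modulo $v$) contain no block. -}

module Defs where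

open import Data.Nat using (ℕ; suc; _+_)
open import Data.Fin using (Fin)
open import Data.Fin.Properties using ()
open import Data.List using (List; length; lookup)
open import Data.Product using (Σ; _×_; _,_; ∃)
open import Data.Sum using (_⊎_)
open import Relation.Binary.PropositionalEquality using (_≡_; _≢_)
open import Relation.Nullary using (¬_)
open import Function.Bundles using (_↔_; Inverse)
open import Data.Nat.DivMod using (_%_)
open import Data.Fin using (fromℕ<; toℕ)
open import Data.Nat.DivMod using (m%n<n)

record Triple (v : ℕ) : Set where
  constructor triple
  field
    a b c : Fin v
    a≢b : a ≢ b
    a≢c : a ≢ c
    b≢c : b ≢ c

open Triple public

_∈T_ : {v : ℕ} → Fin v → Triple v → Set
x ∈T t = (x ≡ a t) ⊎ (x ≡ b t) ⊎ (x ≡ c t)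

-- A Steiner triple system STS(v) on the point set Fin v: a collection (list,
-- so repeated blocks would be counted separately) of blocks such that every
-- pair of distinct points lies in exactly one block.
record STS (v : ℕ) : Set where
  field
    blocks : List (Triple v)
    exactlyOne : (x y : Fin v) → x ≢ y →
      Σ (Fin (length blocks)) λ k →
        (x ∈T lookup blocks k) × (y ∈T lookup blocks k) ×
        ((k′ : Fin (length blocks)) →
           x ∈T lookup blocks k′ → y ∈T lookup blocks k′ → k′ ≡ k)

open STS public

_⊕_ : {n : ℕ} → Fin (suc n) → ℕ → Fin (suc n)
_⊕_ {n} i j = fromℕ< (m%n<n (toℕ i + j) (suc n))

-- An ordering of the points: a bijection from positions Fin v to points.
CyclicGood : {n : ℕ} → ℕ → STS (suc n) → (Fin (suc n) ↔ Fin (suc n)) → Set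
CyclicGood {n} ℓ S σ =
  (i : Fin (suc n)) → (k : Fin (length (blocks S))) →
  ¬ (∀ x → x ∈T lookup (blocks S) k →
       Σ ℕ λ j → (j Data.Nat.< ℓ) × (x ≡ Inverse.to σ (i ⊕ j)))

-- Fix a point p. The blocks through p pair up the other points, and a window holding such a pair
-- {y, y′} together with a point other than p contains no block: the only block through y and y′ is
-- {p, y, y′}. More generally a window is block-free as soon as two of its points lie in a block whose
-- third point is outside the window. Take two pairs {α, α′}, {β, β′} and let δ be the third point of
-- the block through α and β. Then δ is none of p, α, α′, β, β′, so it lies in a third pair {δ, δ′},
-- and the cyclic sequence  β′ p α β α′ δ δ′  followed by the remaining pairs is 3-good: each of its
-- windows is certified by one of the blocks {p, α, α′}, {p, β, β′}, {α, β, δ} or a pair's block.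
module Submission where

open import Defs
open import Data.Nat using (ℕ; zero; suc; _+_; _∸_; _<_; _≤_; z≤n; s≤s; s≤s⁻¹)
import Data.Nat.Properties as ℕ
open import Data.Nat.DivMod using (_%_; m<n⇒m%n≡m; [m+n]%n≡m%n)
open import Data.Fin as Fin using (Fin; toℕ; cast; _≟_)
open import Data.Fin.Properties
  using (toℕ<n; toℕ-fromℕ<; toℕ-cast; cast-involutive; injective⇒≤; <-cmp; <-irrefl; <-asym)
open import Data.List using (List; []; _∷_; length; lookup; _++_; take; map; filter; concatMap; allFin)
open import Data.List.Properties using (length-tabulate; length-++; length-take)
open import Data.List.Relation.Unary.Any as Any using (here; there; any?)
open import Data.List.Relation.Unary.Any.Properties using (lookup-index)
open import Data.List.Relation.Unary.All as All using (All; []; _∷_)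
open import Data.List.Relation.Unary.All.Properties using (All¬⇒¬Any; ¬Any⇒All¬; all-filter)
open import Data.List.Relation.Unary.AllPairs using ([]; _∷_)
open import Data.List.Relation.Unary.Unique.Propositional using (Unique)
import Data.List.Relation.Unary.Unique.Propositional.Properties as Unique
open import Data.List.Relation.Binary.Subset.Propositional using (_⊆_)
open import Data.List.Relation.Binary.Permutation.Propositional
  using (_↭_; prep; swap; ↭-refl; ↭-sym; ↭-trans; ↭⇒↭ₛ; module PermutationReasoning)
open import Data.List.Relation.Binary.Permutation.Propositional.Properties
  using (∈-resp-↭; ++⁺ˡ; shift; shifts)
import Data.List.Relation.Binary.Permutation.Setoid.Properties as SetoidPermutation
open import Data.List.Membership.Propositional using (_∈_; _∉_; find)
open import Data.List.Membership.Propositional.Properties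
  using (∈-lookup; ∈-allFin; ∈-filter⁺; ∈-++⁺ˡ; ∈-++⁺ʳ; ∈-++⁻; ∈-map⁺; ∈-map⁻)
import Data.List.Membership.DecPropositional as DecMembership
open import Data.Product using (Σ; ∃; ∃₂; _×_; _,_; proj₁; proj₂)
open import Data.Sum using (inj₁; inj₂; fromInj₂)
open import Data.Unit using (⊤; tt)
open import Data.Empty using (⊥-elim)
open import Function using (_∘_; id; case_of_)
open import Function.Bundles using (_↔_; Inverse; mk↔ₛ′)
open import Relation.Binary using (DecidableEquality; tri<; tri≈; tri>)
open import Relation.Binary.PropositionalEquality
  using (_≡_; _≢_; refl; sym; trans; cong; cong₂; subst; ≢-sym; setoid; module ≡-Reasoning)
open import Relation.Nullary using (¬_; Dec; yes; no; contradiction)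
open import Relation.Nullary.Decidable using (decidable-stable)

module _ {A : Set} where

  lookup-injective : {xs : List A} → Unique xs →
    {i j : Fin (length xs)} → lookup xs i ≡ lookup xs j → i ≡ j
  lookup-injective {_ ∷ _}  _           {Fin.zero}  {Fin.zero}  _  = refl
  lookup-injective {_ ∷ _}  (x∉xs ∷ _)  {Fin.zero}  {Fin.suc j} eq = ⊥-elim (All.lookup x∉xs (∈-lookup j) eq)
  lookup-injective {_ ∷ _}  (x∉xs ∷ _)  {Fin.suc i} {Fin.zero}  eq = ⊥-elim (All.lookup x∉xs (∈-lookup i) (sym eq))
  lookup-injective {_ ∷ _}  (_ ∷ uniq) {Fin.suc i} {Fin.suc j} eq = cong Fin.suc (lookup-injective uniq eq)

  unique-⊆⇒length≤ : {xs ys : List A} → Unique xs → xs ⊆ ys → length xs ≤ length ys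
  unique-⊆⇒length≤ {xs} {ys} uniq xs⊆ys = injective⇒≤ position-injective
    where
    position : Fin (length xs) → Fin (length ys)
    position i = Any.index (xs⊆ys (∈-lookup i))

    position-injective : ∀ {i j} → position i ≡ position j → i ≡ j
    position-injective {i} {j} eq = lookup-injective uniq (begin
      lookup xs i            ≡⟨ lookup-index (xs⊆ys (∈-lookup i)) ⟩
      lookup ys (position i) ≡⟨ cong (lookup ys) eq ⟩
      lookup ys (position j) ≡⟨ lookup-index (xs⊆ys (∈-lookup j)) ⟨
      lookup xs j            ∎)
      where open ≡-Reasoning

  unique-resp-↭ : {xs ys : List A} → xs ↭ ys → Unique xs → Unique ys
  unique-resp-↭ xs↭ys = SetoidPermutation.Unique-resp-↭ (setoid A) (↭⇒↭ₛ xs↭ys)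

  concatMap-pairs-↭ : (g : A → A) (xs : List A) → concatMap (λ x → x ∷ g x ∷ []) xs ↭ xs ++ map g xs
  concatMap-pairs-↭ g []       = ↭-refl
  concatMap-pairs-↭ g (x ∷ xs) =
    prep x (↭-trans (prep (g x) (concatMap-pairs-↭ g xs)) (↭-sym (shift (g x) xs (map g xs))))

module _ {A : Set} (_≟ᴬ_ : DecidableEquality A) where

  open DecMembership _≟ᴬ_ using (_∈?_; _∉?_)

  ⊆-by-length : {xs ys : List A} → Unique xs → xs ⊆ ys → length ys ≤ length xs → ys ⊆ xs
  ⊆-by-length {xs} {ys} uniq xs⊆ys |ys|≤|xs| {y} y∈ys with y ∈? xs
  ... | yes y∈xs = y∈xs
  ... | no  y∉xs = contradiction (unique-⊆⇒length≤ (¬Any⇒All¬ xs y∉xs ∷ uniq) y∷xs⊆ys) (ℕ.≤⇒≯ |ys|≤|xs|)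
    where
    y∷xs⊆ys : y ∷ xs ⊆ ys
    y∷xs⊆ys (here refl) = y∈ys
    y∷xs⊆ys (there x∈xs) = xs⊆ys x∈xs

  ∃-∉ : {xs ys : List A} → Unique xs → length ys < length xs → ∃ λ x → x ∈ xs × x ∉ ys
  ∃-∉ {xs} {ys} uniq |ys|<|xs| with any? (_∉? ys) xs
  ... | yes some = find some
  ... | no  none = contradiction (unique-⊆⇒length≤ uniq xs⊆ys) (ℕ.<⇒≱ |ys|<|xs|)
    where
    xs⊆ys : xs ⊆ ys
    xs⊆ys {x} x∈xs = decidable-stable (x ∈? ys) (All.lookup (¬Any⇒All¬ xs none) x∈xs)

module _ {A : Set} where

  Linked₃ : (A → A → A → Set) → List A → Set
  Linked₃ P (x ∷ y ∷ z ∷ xs) = P x y z × Linked₃ P (y ∷ z ∷ xs)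
  Linked₃ P _                = ⊤

  nth : A → List A → ℕ → A
  nth d []       _       = d
  nth d (x ∷ _)  zero    = x
  nth d (_ ∷ xs) (suc m) = nth d xs m

  module _ (d : A) where

    lookup≡nth : (xs : List A) (i : Fin (length xs)) → lookup xs i ≡ nth d xs (toℕ i)
    lookup≡nth (_ ∷ _)  Fin.zero    = refl
    lookup≡nth (_ ∷ xs) (Fin.suc i) = lookup≡nth xs i

    nth-++ˡ : (xs ys : List A) {m : ℕ} → m < length xs → nth d (xs ++ ys) m ≡ nth d xs m
    nth-++ˡ (_ ∷ _)  ys {zero}  _          = refl
    nth-++ˡ (_ ∷ xs) ys {suc m} (s≤s m<xs) = nth-++ˡ xs ys m<xs

    nth-++ʳ : (xs ys : List A) (m : ℕ) → nth d (xs ++ ys) (length xs + m) ≡ nth d ys m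
    nth-++ʳ []       ys m = refl
    nth-++ʳ (_ ∷ xs) ys m = nth-++ʳ xs ys m

    nth-take : (k : ℕ) (xs : List A) {m : ℕ} → m < k → nth d (take k xs) m ≡ nth d xs m
    nth-take (suc k) []       _          = refl
    nth-take (suc k) (_ ∷ _)  {zero}  _  = refl
    nth-take (suc k) (_ ∷ xs) {suc m} (s≤s m<k) = nth-take k xs m<k

    linked₃-nth : {P : A → A → A → Set} {ys : List A} (m : ℕ) → Linked₃ P ys → suc (suc m) < length ys →
      P (nth d ys m) (nth d ys (suc m)) (nth d ys (suc (suc m)))
    linked₃-nth {ys = _ ∷ _ ∷ _ ∷ _} zero    (Pxyz , _)   _          = Pxyz
    linked₃-nth {ys = _ ∷ _ ∷ _ ∷ _} (suc m) (_ , linked) (s≤s m<ys) = linked₃-nth m linked m<ys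
    linked₃-nth {ys = _ ∷ _ ∷ []}    m       _            (s≤s (s≤s ()))
    linked₃-nth {ys = _ ∷ []}        m       _            (s≤s ())
    linked₃-nth {ys = []}            m       _            ()

    nth-cyclic : {n : ℕ} (xs : List A) → length xs ≡ suc n → 2 ≤ suc n → (m : ℕ) → m < suc n + 2 →
      nth d xs (m % suc n) ≡ nth d (xs ++ take 2 xs) m
    nth-cyclic {n} xs |xs|≡ 2≤ m m< with m ℕ.<? suc n
    ... | yes m<1+n = begin
      nth d xs (m % suc n)        ≡⟨ cong (nth d xs) (m<n⇒m%n≡m m<1+n) ⟩
      nth d xs m                  ≡⟨ nth-++ˡ xs (take 2 xs) (subst (m <_) (sym |xs|≡) m<1+n) ⟨
      nth d (xs ++ take 2 xs) m   ∎
      where open ≡-Reasoning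
    ... | no m≮1+n = begin
      nth d xs (m % suc n)                    ≡⟨ cong (λ k → nth d xs (k % suc n)) 1+n+e≡m ⟨
      nth d xs ((suc n + e) % suc n)          ≡⟨ cong (nth d xs) [1+n+e]%[1+n]≡e ⟩
      nth d xs e                              ≡⟨ nth-take 2 xs e<2 ⟨
      nth d (take 2 xs) e                     ≡⟨ nth-++ʳ xs (take 2 xs) e ⟨
      nth d (xs ++ take 2 xs) (length xs + e) ≡⟨ cong (λ k → nth d (xs ++ take 2 xs) (k + e)) |xs|≡ ⟩
      nth d (xs ++ take 2 xs) (suc n + e)     ≡⟨ cong (nth d (xs ++ take 2 xs)) 1+n+e≡m ⟩
      nth d (xs ++ take 2 xs) m               ∎
      where
      open ≡-Reasoning

      e : ℕ
      e = m ∸ suc n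

      1+n+e≡m : suc n + e ≡ m
      1+n+e≡m = ℕ.m+[n∸m]≡n (ℕ.≮⇒≥ m≮1+n)

      e<2 : e < 2
      e<2 = ℕ.+-cancelˡ-< (suc n) e 2 (subst (_< suc n + 2) (sym 1+n+e≡m) m<)

      [1+n+e]%[1+n]≡e : (suc n + e) % suc n ≡ e
      [1+n+e]%[1+n]≡e = begin
        (suc n + e) % suc n ≡⟨ cong (_% suc n) (ℕ.+-comm (suc n) e) ⟩
        (e + suc n) % suc n ≡⟨ [m+n]%n≡m%n e (suc n) ⟩
        e % suc n           ≡⟨ m<n⇒m%n≡m (ℕ.<-≤-trans e<2 2≤) ⟩
        e                   ∎

    length-cyclic : {n : ℕ} (xs : List A) → length xs ≡ suc n → 2 ≤ suc n → length (xs ++ take 2 xs) ≡ suc n + 2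
    length-cyclic xs |xs|≡ 2≤ = trans (length-++ xs) (cong₂ _+_ |xs|≡
      (trans (length-take 2 xs) (ℕ.m≤n⇒m⊓n≡m (subst (2 ≤_) (sym |xs|≡) 2≤))))

    lookup-cyclic : {n : ℕ} (xs : List A) (|xs|≡ : length xs ≡ suc n) → 2 ≤ suc n →
      (i : Fin (suc n)) {j : ℕ} → j < 3 → lookup xs (cast (sym |xs|≡) (i ⊕ j)) ≡ nth d (xs ++ take 2 xs) (toℕ i + j)
    lookup-cyclic {n} xs |xs|≡ 2≤ i {j} j<3 = begin
      lookup xs (cast (sym |xs|≡) (i ⊕ j))      ≡⟨ lookup≡nth xs _ ⟩
      nth d xs (toℕ (cast (sym |xs|≡) (i ⊕ j))) ≡⟨ cong (nth d xs) (trans (toℕ-cast _ (i ⊕ j)) (toℕ-fromℕ< _)) ⟩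
      nth d xs ((toℕ i + j) % suc n)            ≡⟨ nth-cyclic xs |xs|≡ 2≤ (toℕ i + j) (ℕ.+-mono-<-≤ (toℕ<n i) (s≤s⁻¹ j<3)) ⟩
      nth d (xs ++ take 2 xs) (toℕ i + j)       ∎
      where open ≡-Reasoning

module _ {m : ℕ} where

  length-enumeration : {xs : List (Fin m)} → Unique xs → (∀ y → y ∈ xs) → length xs ≡ m
  length-enumeration {xs} uniq complete = ℕ.≤-antisym
    (injective⇒≤ (lookup-injective uniq))
    (subst (_≤ length xs) (length-tabulate id) (unique-⊆⇒length≤ (Unique.allFin⁺ m) (λ {y} _ → complete y)))

  enumeration : (xs : List (Fin m)) → Unique xs → (∀ y → y ∈ xs) → Fin m ↔ Fin m
  enumeration xs uniq complete = mk↔ₛ′ to from to∘from from∘to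
    where
    |xs|≡m : length xs ≡ m
    |xs|≡m = length-enumeration uniq complete

    to : Fin m → Fin m
    to i = lookup xs (cast (sym |xs|≡m) i)

    from : Fin m → Fin m
    from y = cast |xs|≡m (Any.index (complete y))

    to∘from : ∀ y → to (from y) ≡ y
    to∘from y = trans (cong (lookup xs) (cast-involutive (sym |xs|≡m) |xs|≡m _)) (sym (lookup-index (complete y)))

    from∘to : ∀ i → from (to i) ≡ i
    from∘to i = trans (cong (cast |xs|≡m) (lookup-injective uniq (sym (lookup-index (complete (to i))))))
                      (cast-involutive |xs|≡m (sym |xs|≡m) i)

  module _ (f : Fin m → Fin m) (f-involutive : ∀ x → f (f x) ≡ x) where

    lower? : (x : Fin m) → Dec (x Fin.< f x)
    lower? x = x Fin.<? f x

    minima : List (Fin m)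
    minima = filter lower? (allFin m)

    minima-lower : All (λ x → x Fin.< f x) minima
    minima-lower = all-filter lower? (allFin m)

    moved : List (Fin m)
    moved = minima ++ map f minima

    moved-unique : Unique moved
    moved-unique = Unique.++⁺ minima-unique (Unique.map⁺ f-injective minima-unique) disjoint
      where
      minima-unique : Unique minima
      minima-unique = Unique.filter⁺ lower? (Unique.allFin⁺ m)

      f-injective : ∀ {x y} → f x ≡ f y → x ≡ y
      f-injective {x} {y} eq = trans (sym (f-involutive x)) (trans (cong f eq) (f-involutive y))

      disjoint : ∀ {x} → ¬ (x ∈ minima × x ∈ map f minima)
      disjoint (x∈minima , x∈fminima) with ∈-map⁻ f x∈fminima
      ... | r , r∈minima , refl =
        <-asym (All.lookup minima-lower r∈minima) (subst (f r Fin.<_) (f-involutive r) (All.lookup minima-lower x∈minima))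

    ∈-moved⁺ : ∀ {x} → f x ≢ x → x ∈ moved
    ∈-moved⁺ {x} fx≢x with <-cmp x (f x)
    ... | tri< x<fx _ _ = ∈-++⁺ˡ (∈-filter⁺ lower? (∈-allFin x) x<fx)
    ... | tri≈ _ x≡fx _ = contradiction (sym x≡fx) fx≢x
    ... | tri> _ _ fx<x = ∈-++⁺ʳ minima (subst (_∈ map f minima) (f-involutive x)
            (∈-map⁺ f (∈-filter⁺ lower? (∈-allFin (f x)) (subst (f x Fin.<_) (sym (f-involutive x)) fx<x))))

    ∈-moved⁻ : ∀ {x} → x ∈ moved → f x ≢ x
    ∈-moved⁻ {x} x∈ with ∈-++⁻ minima x∈
    ... | inj₁ x∈minima = λ fx≡x → <-irrefl (sym fx≡x) (All.lookup minima-lower x∈minima)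
    ... | inj₂ x∈fminima with ∈-map⁻ f x∈fminima
    ...   | r , r∈minima , refl = λ ffr≡fr → <-irrefl (trans (sym (f-involutive r)) ffr≡fr) (All.lookup minima-lower r∈minima)

module _ {v : ℕ} where

  points : Triple v → List (Fin v)
  points t = a t ∷ b t ∷ c t ∷ []

  points-unique : (t : Triple v) → Unique (points t)
  points-unique t = (a≢b t ∷ a≢c t ∷ []) ∷ (b≢c t ∷ []) ∷ [] ∷ []

  ∈T⇒∈points : {x : Fin v} (t : Triple v) → x ∈T t → x ∈ points t
  ∈T⇒∈points t (inj₁ x≡a)        = here x≡a
  ∈T⇒∈points t (inj₂ (inj₁ x≡b)) = there (here x≡b)
  ∈T⇒∈points t (inj₂ (inj₂ x≡c)) = there (there (here x≡c))

  ∈points⇒∈T : {x : Fin v} (t : Triple v) → x ∈ points t → x ∈T t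
  ∈points⇒∈T t (here x≡a)                = inj₁ x≡a
  ∈points⇒∈T t (there (here x≡b))        = inj₂ (inj₁ x≡b)
  ∈points⇒∈T t (there (there (here x≡c))) = inj₂ (inj₂ x≡c)

module _ {n : ℕ} (S : STS (suc n)) where

  private
    V : Set
    V = Fin (suc n)

    K : Set
    K = Fin (length (blocks S))

    B : K → Triple (suc n)
    B = lookup (blocks S)

    variable
      x y z t u w : V

  record Line (x y z : V) : Set where
    constructor line
    field
      block : K
      ∈₁ : x ∈T B block
      ∈₂ : y ∈T B block
      ∈₃ : z ∈T B block
      ≢₁₂ : x ≢ y
      ≢₁₃ : x ≢ z
      ≢₂₃ : y ≢ z

  open Line

  line-swap₁₂ : Line x y z → Line y x z
  line-swap₁₂ (line k x∈ y∈ z∈ x≢y x≢z y≢z) = line k y∈ x∈ z∈ (≢-sym x≢y) y≢z x≢z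

  line-swap₂₃ : Line x y z → Line x z y
  line-swap₂₃ (line k x∈ y∈ z∈ x≢y x≢z y≢z) = line k x∈ z∈ y∈ x≢z x≢y (≢-sym y≢z)

  line-rotate : Line x y z → Line y z x
  line-rotate = line-swap₂₃ ∘ line-swap₁₂

  same-block : {k k′ : K} → x ≢ y → x ∈T B k → y ∈T B k → x ∈T B k′ → y ∈T B k′ → k ≡ k′
  same-block {x} {y} x≢y x∈k y∈k x∈k′ y∈k′ with exactlyOne S x y x≢y
  ... | _ , _ , _ , only = trans (only _ x∈k y∈k) (sym (only _ x∈k′ y∈k′))

  line-through : x ≢ y → ∃ (Line x y)
  line-through {x} {y} x≢y with exactlyOne S x y x≢y
  ... | k , x∈ , y∈ , _ with ∃-∉ _≟_ {ys = x ∷ y ∷ []} (points-unique (B k)) ℕ.≤-refl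
  ...   | z , z∈ , z∉ = z , line k x∈ y∈ (∈points⇒∈T (B k) z∈) x≢y (z∉ ∘ here ∘ sym) (z∉ ∘ there ∘ here ∘ sym)

  line-third-unique : Line x y z → Line x y w → z ≡ w
  line-third-unique {x} {y} {z} (line k x∈ y∈ z∈ x≢y x≢z y≢z) (line k′ x∈′ y∈′ w∈ _ x≢w y≢w)
    with same-block x≢y x∈′ y∈′ x∈ y∈
  ... | refl with ⊆-by-length _≟_ xyz-unique xyz⊆points ℕ.≤-refl (∈T⇒∈points (B k) w∈)
    where
    xyz-unique : Unique (x ∷ y ∷ z ∷ [])
    xyz-unique = (x≢y ∷ x≢z ∷ []) ∷ (y≢z ∷ []) ∷ [] ∷ []

    xyz⊆points : x ∷ y ∷ z ∷ [] ⊆ points (B k)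
    xyz⊆points (here refl)                = ∈T⇒∈points (B k) x∈
    xyz⊆points (there (here refl))        = ∈T⇒∈points (B k) y∈
    xyz⊆points (there (there (here refl))) = ∈T⇒∈points (B k) z∈
  ... | here w≡x                 = contradiction (sym w≡x) x≢w
  ... | there (here w≡y)         = contradiction (sym w≡y) y≢w
  ... | there (there (here w≡z)) = sym w≡z

  line-third-distinct : Line x y z → Line x w u → y ≢ u → z ≢ w
  line-third-distinct xyz xwu y≢u refl = y≢u (line-third-unique (line-swap₂₃ xyz) xwu)

  Free : List V → Set
  Free W = (k : K) → ¬ (∀ x → x ∈T B k → x ∈ W)

  -- A block inside a window of at most three points fills the window, so it is the block through x and y.
  free-by-line : {W : List V} → length W ≤ 3 → x ∈ W → y ∈ W → Line x y t → t ∉ W → Free W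
  free-by-line {W = W} |W|≤3 x∈W y∈W (line k₀ x∈k₀ y∈k₀ t∈k₀ x≢y _ _) t∉W k Bk⊆W =
    t∉W (Bk⊆W _ (subst (λ k → _ ∈T B k) k₀≡k t∈k₀))
    where
    W⊆Bk : W ⊆ points (B k)
    W⊆Bk = ⊆-by-length _≟_ (points-unique (B k)) (Bk⊆W _ ∘ ∈points⇒∈T (B k)) |W|≤3

    k₀≡k : k₀ ≡ k
    k₀≡k = same-block x≢y x∈k₀ y∈k₀ (∈points⇒∈T (B k) (W⊆Bk x∈W)) (∈points⇒∈T (B k) (W⊆Bk y∈W))

  Free₃ : V → V → V → Set
  Free₃ x y z = Free (x ∷ y ∷ z ∷ [])

  free₁₂ : Line x y t → t ≢ z → Free₃ x y z
  free₁₂ l t≢z = free-by-line ℕ.≤-refl (here refl) (there (here refl)) l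
    (All¬⇒¬Any (≢-sym (≢₁₃ l) ∷ ≢-sym (≢₂₃ l) ∷ t≢z ∷ []))

  free₁₃ : Line x z t → t ≢ y → Free₃ x y z
  free₁₃ l t≢y = free-by-line ℕ.≤-refl (here refl) (there (there (here refl))) l
    (All¬⇒¬Any (≢-sym (≢₁₃ l) ∷ t≢y ∷ ≢-sym (≢₂₃ l) ∷ []))

  free₂₃ : Line y z t → t ≢ x → Free₃ x y z
  free₂₃ l t≢x = free-by-line ℕ.≤-refl (there (here refl)) (there (there (here refl))) l
    (All¬⇒¬Any (t≢x ∷ ≢-sym (≢₁₃ l) ∷ ≢-sym (≢₂₃ l) ∷ []))

  cyclic-good : (xs : List V) (uniq : Unique xs) (complete : ∀ y → y ∈ xs) → 2 ≤ suc n →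
    Linked₃ Free₃ (xs ++ take 2 xs) → CyclicGood 3 S (enumeration xs uniq complete)
  cyclic-good xs uniq complete 2≤ free i k Bk⊆window =
    linked₃-nth Fin.zero m free bound k (λ x x∈Bk → in-window (Bk⊆window x x∈Bk))
    where
    |xs|≡ : length xs ≡ suc n
    |xs|≡ = length-enumeration uniq complete

    m : ℕ
    m = toℕ i

    at : ℕ → V
    at = nth Fin.zero (xs ++ take 2 xs)

    bound : suc (suc m) < length (xs ++ take 2 xs)
    bound = subst (suc (suc m) <_) (sym (trans (length-cyclic Fin.zero xs |xs|≡ 2≤) (ℕ.+-comm (suc n) 2)))
      (ℕ.+-monoʳ-< 2 (toℕ<n i))

    in-window : Σ ℕ (λ j → j < 3 × x ≡ Inverse.to (enumeration xs uniq complete) (i ⊕ j)) →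
      x ∈ at m ∷ at (suc m) ∷ at (suc (suc m)) ∷ []
    in-window (j , j<3 , x≡) with trans x≡ (lookup-cyclic Fin.zero xs |xs|≡ 2≤ i j<3)
    in-window (0 , _ , _) | x≡ = here (trans x≡ (cong at (ℕ.+-identityʳ m)))
    in-window (1 , _ , _) | x≡ = there (here (trans x≡ (cong at (ℕ.+-comm m 1))))
    in-window (2 , _ , _) | x≡ = there (there (here (trans x≡ (cong at (ℕ.+-comm m 2)))))
    in-window (suc (suc (suc _)) , s≤s (s≤s (s≤s ())) , _) | _

  module _ (p : V) where

    partner : V → V
    partner x with x ≟ p
    ... | yes _   = p
    ... | no  x≢p = proj₁ (line-through (≢-sym x≢p))

    partner-line : x ≢ p → Line p x (partner x)
    partner-line {x} x≢p with x ≟ p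
    ... | yes x≡p  = contradiction x≡p x≢p
    ... | no  x≢p′ = proj₂ (line-through (≢-sym x≢p′))

    partner-p : partner p ≡ p
    partner-p with p ≟ p
    ... | yes _   = refl
    ... | no  p≢p = contradiction refl p≢p

    partner-involutive : ∀ x → partner (partner x) ≡ x
    partner-involutive x = case x ≟ p of λ where
      (yes refl) → trans (cong partner partner-p) partner-p
      (no  x≢p)  → let px = partner-line x≢p in
                   line-third-unique (partner-line (≢-sym (≢₁₃ px))) (line-swap₂₃ px)

    data Paired : List V → Set where
      []  : Paired []
      _∷_ : {y y′ : V} {ys : List V} → Line p y y′ → Paired ys → Paired (y ∷ y′ ∷ ys)

    pencil : List V
    pencil = concatMap (λ r → r ∷ partner r ∷ []) (minima partner partner-involutive)

    pencil-paired : Paired pencil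
    pencil-paired = paired (minima-lower partner partner-involutive)
      where
      paired : {rs : List V} → All (λ r → r Fin.< partner r) rs → Paired (concatMap (λ r → r ∷ partner r ∷ []) rs)
      paired []             = []
      paired (r<r′ ∷ r<r′s) = partner-line (λ { refl → <-irrefl (sym partner-p) r<r′ }) ∷ paired r<r′s

    pencil↭moved : pencil ↭ moved partner partner-involutive
    pencil↭moved = concatMap-pairs-↭ partner (minima partner partner-involutive)

    pencil-unique : Unique (p ∷ pencil)
    pencil-unique = ¬Any⇒All¬ pencil p∉pencil
      ∷ unique-resp-↭ (↭-sym pencil↭moved) (moved-unique partner partner-involutive)
      where
      p∉pencil : p ∉ pencil
      p∉pencil p∈ = ∈-moved⁻ partner partner-involutive (∈-resp-↭ pencil↭moved p∈) partner-p

    pencil-complete : ∀ y → y ∈ p ∷ pencil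
    pencil-complete y = case y ≟ p of λ where
      (yes y≡p) → here y≡p
      (no  y≢p) → there (∈-resp-↭ (↭-sym pencil↭moved)
                    (∈-moved⁺ partner partner-involutive (≢-sym (≢₂₃ (partner-line y≢p)))))

    windows-along : {ys : List V} → Paired ys → u ≢ p → Line p z t → t ∉ u ∷ ys →
      Linked₃ Free₃ (u ∷ ys ++ z ∷ p ∷ [])
    windows-along [] u≢p pzt t∉ = free₂₃ (line-swap₁₂ pzt) (t∉ ∘ here) , tt
    windows-along (pyy′ ∷ []) u≢p pzt t∉ =
      free₂₃ (line-rotate pyy′) (≢-sym u≢p) , free₁₂ (line-rotate pyy′) (≢₁₂ pzt) ,
      windows-along [] (≢-sym (≢₁₃ pyy′)) pzt (t∉ ∘ there ∘ there)
    windows-along (pyy′ ∷ pww′ ∷ ps) u≢p pzt t∉ =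
      free₂₃ (line-rotate pyy′) (≢-sym u≢p) , free₁₂ (line-rotate pyy′) (≢₁₂ pww′) ,
      windows-along (pww′ ∷ ps) (≢-sym (≢₁₃ pyy′)) pzt (t∉ ∘ there ∘ there)

    paired-extract : {ys : List V} → Paired ys → x ∈ ys →
      ∃₂ λ x′ ys′ → Line p x x′ × Paired ys′ × ys ↭ x ∷ x′ ∷ ys′
    paired-extract (pyy′ ∷ ps) (here refl)         = _ , _ , pyy′ , ps , ↭-refl
    paired-extract (pyy′ ∷ ps) (there (here refl)) = _ , _ , line-swap₂₃ pyy′ , ps , swap _ _ ↭-refl
    paired-extract {x = x} (_∷_ {y} {y′} pyy′ ps) (there (there x∈)) with paired-extract ps x∈
    ... | x′ , ys′ , pxx′ , ps′ , ys↭ =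
      x′ , y ∷ y′ ∷ ys′ , pxx′ , pyy′ ∷ ps′ ,
      ↭-trans (++⁺ˡ (y ∷ y′ ∷ []) ys↭) (shifts (y ∷ y′ ∷ []) (x ∷ x′ ∷ []))

    third-point-avoids-pairs : {α α′ β β′ δ : V} → Line p α α′ → Line p β β′ → Line α β δ → α′ ≢ β →
      δ ∉ p ∷ α ∷ α′ ∷ β ∷ β′ ∷ []
    third-point-avoids-pairs pαα′ pββ′ αβδ α′≢β = All¬⇒¬Any
      ( line-third-distinct αβδ (line-swap₁₂ pαα′) (≢-sym α′≢β)
      ∷ ≢-sym (≢₁₃ αβδ)
      ∷ line-third-distinct αβδ (line-rotate pαα′) (≢-sym (≢₁₂ pββ′))
      ∷ ≢-sym (≢₂₃ αβδ)
      ∷ line-third-distinct (line-swap₁₂ αβδ) (line-rotate pββ′) (≢-sym (≢₁₂ pαα′))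
      ∷ [])

    windows-arrangement : {α α′ β β′ δ δ′ : V} {ηs : List V} →
      Line p α α′ → Line p β β′ → Line α β δ → Line p δ δ′ → Paired ηs →
      Unique (β′ ∷ p ∷ α ∷ β ∷ α′ ∷ δ ∷ δ′ ∷ ηs) →
      Linked₃ Free₃ (β′ ∷ p ∷ α ∷ β ∷ α′ ∷ δ ∷ δ′ ∷ ηs ++ β′ ∷ p ∷ [])
    windows-arrangement pαα′ pββ′ αβδ pδδ′ ps
                        ((_ ∷ _ ∷ _ ∷ β′≢α′ ∷ _) ∷ _ ∷ _ ∷ β∉@(β≢α′ ∷ _) ∷ (α′≢δ ∷ _) ∷ _) =
      free₂₃ pαα′ (≢-sym β′≢α′) , free₁₂ pαα′ (≢-sym β≢α′) , free₁₂ αβδ (≢-sym α′≢δ) ,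
      free₁₃ (line-rotate αβδ) (≢₂₃ pαα′) ,
      windows-along (pδδ′ ∷ ps) (≢-sym (≢₁₃ pαα′)) (line-swap₂₃ pββ′) (All¬⇒¬Any β∉)

    paired-cyclic-arrangement : {zs : List V} → Paired zs → Unique (p ∷ zs) → (∀ y → y ∈ p ∷ zs) → 3 < length (p ∷ zs) →
      ∃ λ xs → Unique xs × (∀ y → y ∈ xs) × Linked₃ Free₃ (xs ++ take 2 xs)
    paired-cyclic-arrangement []       _ _ (s≤s ())
    paired-cyclic-arrangement (_ ∷ []) _ _ (s≤s (s≤s (s≤s ())))
    paired-cyclic-arrangement {α ∷ α′ ∷ β ∷ β′ ∷ γs} (pαα′ ∷ pββ′ ∷ ps)
                       uniq@(_ ∷ (_ ∷ α≢β ∷ _) ∷ (α′≢β ∷ _) ∷ _) complete _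
      with line-through α≢β
    ... | δ , αβδ
      with paired-extract ps (fromInj₂ (⊥-elim ∘ third-point-avoids-pairs pαα′ pββ′ αβδ α′≢β)
                                       (∈-++⁻ (p ∷ α ∷ α′ ∷ β ∷ β′ ∷ []) (complete δ)))
    ... | δ′ , ηs , pδδ′ , ps′ , γs↭ =
      xs , xs-unique , (λ y → ∈-resp-↭ perm (complete y)) , windows-arrangement pαα′ pββ′ αβδ pδδ′ ps′ xs-unique
      where
      xs : List V
      xs = β′ ∷ p ∷ α ∷ β ∷ α′ ∷ δ ∷ δ′ ∷ ηs

      perm : p ∷ α ∷ α′ ∷ β ∷ β′ ∷ γs ↭ xs
      perm = begin
        p ∷ α ∷ α′ ∷ β ∷ β′ ∷ γs           ↭⟨ ++⁺ˡ (p ∷ α ∷ α′ ∷ β ∷ β′ ∷ []) γs↭ ⟩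
        p ∷ α ∷ α′ ∷ β ∷ β′ ∷ δ ∷ δ′ ∷ ηs  ↭⟨ prep p (prep α (swap α′ β ↭-refl)) ⟩
        p ∷ α ∷ β ∷ α′ ∷ β′ ∷ δ ∷ δ′ ∷ ηs  ↭⟨ shift β′ (p ∷ α ∷ β ∷ α′ ∷ []) (δ ∷ δ′ ∷ ηs) ⟩
        xs                                 ∎
        where open PermutationReasoning

      xs-unique : Unique xs
      xs-unique = unique-resp-↭ perm uniq

    cyclic-arrangement : 3 < suc n → ∃ λ xs → Unique xs × (∀ y → y ∈ xs) × Linked₃ Free₃ (xs ++ take 2 xs)
    cyclic-arrangement 3<v = paired-cyclic-arrangement pencil-paired pencil-unique pencil-complete
      (subst (3 <_) (sym (length-enumeration pencil-unique pencil-complete)) 3<v)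

theorem1p4 : (n : ℕ) → 3 < suc n → (S : STS (suc n)) →
    Σ (Fin (suc n) ↔ Fin (suc n)) λ σ → CyclicGood 3 S σ
theorem1p4 n 3<v S with cyclic-arrangement S Fin.zero 3<v
... | xs , uniq , complete , free =
  enumeration xs uniq complete , cyclic-good S xs uniq complete (ℕ.≤-trans (ℕ.n≤1+n 2) (ℕ.<⇒≤ 3<v)) free
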